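{- Let $p$ be an odd prime and let $n,s$ be positive integers such that $2n/s \geq 3$ is an odd integer; put $q = p^n$, $d = p^s$, and $f(X) = X^{d+1}$. Let $\mathcal{A}_{q^2,d}$ be the graph with vertex set $\mathbb{F}_{q^2} \times \mathbb{F}_{q^2}$ in which distinct vertices $(a^d + a, x)$ and $(b^d + b, y)$ (with $a,b,x,y \in \mathbb{F}_{q^2}$) are adjacent iff $a^d b + a b^d = x + y$. Then $\mathcal{A}_{q^2,d}$ is isomorphic to the subgraph of $G_f$ induced by the set of points $\{(x,y) : x,y \in \mathbb{F}_{q^2}\}$.
   Context: The map $x \mapsto x^d + x$ is a bijection of $\mathbb{F}_{q^2}$, so every element of $\mathbb{F}_{q^2}$ is uniquely of the form $a^d + a$, making the definition of $\mathcal{A}_{q^2,d}$ meaningful. $f(X)=X^{d+1}$ is a planar polynomial over $\mathbb{F}_{q^2}$. $G_f$ is the orthogonal polarity graph: its vertices are the points $(x,y)$ ($x,y\in\mathbb{F}_{q^2}$), $(x)$ ($x\in\mathbb{F}_{q^2}$), $(\infty)$ of the plane $\Pi_f$ whose lines are $[a,b] = \{(x, f(x-a)+b)\} \cup \{(a)\}$, $[c] = \{(c,y)\} \cup \{(\infty)\}$, $[\infty] = \{(c)\} \cup \{(\infty)\}$, with polarity $(x,y)^\omega = [-x,-y]$, $(c)^\omega = [-c]$, $(\infty)^\omega = [\infty]$ (and inversely on lines); distinct points $p_1,p_2$ are adjacent iff $p_1 \in p_2^\omega$. In particular distinct $(x_1,y_1),(x_2,y_2)$ are adjacent iff $f(x_1+x_2)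 = y_1+y_2$. -}

module Defs where

open import Level using (0ℓ)
open import Data.Nat as ℕ using (ℕ; zero; suc)
open import Data.Fin using (Fin)
open import Data.Product using (Σ; ∃; _×_; _,_)
open import Relation.Nullary using (¬_)
open import Relation.Binary.PropositionalEquality using (_≡_)
open import Algebra.Structures using (IsCommutativeRing)
open import Function.Bundles using (_↔_; _⤖_; Inverse)

record Field : Set₁ where
  infixl 7 _*_
  infixl 6 _+_
  field
    Carrier : Set
    _+_ _*_ : Carrier → Carrier → Carrier
    -_      : Carrier → Carrier
    0# 1#   : Carrier
    isCommutativeRing : IsCommutativeRing _≡_ _+_ _*_ -_ 0# 1#
    0≢1     : ¬ (0# ≡ 1#)
    inverse : ∀ x → ¬ (x ≡ 0#) → Σ Carrier λ y → x * y ≡ 1#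

  _-_ : Carrier → Carrier → Carrier
  x - y = x + (- y)

  _^_ : Carrier → ℕ → Carrier
  x ^ zero  = 1#
  x ^ suc m = x * (x ^ m)

HasOrder : Field → ℕ → Set
HasOrder F m = Field.Carrier F ⤖ Fin m

record Graph : Set₁ where
  field
    Vertex : Set
    Adj    : Vertex → Vertex → Set

_≅_ : Graph → Graph → Set
G ≅ H = Σ (Graph.Vertex G ↔ Graph.Vertex H) λ φ →
  ∀ u v → (Graph.Adj G u v → Graph.Adj H (Inverse.to φ u) (Inverse.to φ v))
        × (Graph.Adj H (Inverse.to φ u) (Inverse.to φ v) → Graph.Adj G u v)

module _ (F : Field) where
  open Field F

  𝒜 : ℕ → Graph
  𝒜 d = record
    { Vertex = Carrier × Carrier
    ; Adj    = λ { (u , x) (v , y) → ¬ ((u , x) ≡ (v , y)) ×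
                   Σ Carrier λ a → Σ Carrier λ b →
                     (u ≡ (a ^ d) + a) × (v ≡ (b ^ d) + b) ×
                     ((a ^ d) * b + a * (b ^ d) ≡ x + y) }
    }

  data Point : Set where
    aff : Carrier → Carrier → Point
    par : Carrier → Point
    ∞p  : Point

  data Line : Set where
    lab : Carrier → Carrier → Line
    ver : Carrier → Line
    ∞l  : Line

  data _∈[_]_ : Point → (Carrier → Carrier) → Line → Set where
    aff∈lab : ∀ {f x y a b} → y ≡ f (x - a) + b → aff x y ∈[ f ] lab a b
    par∈lab : ∀ {f a b} → par a ∈[ f ] lab a b
    aff∈ver : ∀ {f c y} → aff c y ∈[ f ] ver c
    ∞∈ver   : ∀ {f c} → ∞p ∈[ f ] ver c
    par∈∞   : ∀ {f c} → par c ∈[ f ] ∞l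
    ∞∈∞     : ∀ {f} → ∞p ∈[ f ] ∞l

  ω : Point → Line
  ω (aff x y) = lab (- x) (- y)
  ω (par c)   = ver (- c)
  ω ∞p        = ∞l

  G : (Carrier → Carrier) → Graph
  G f = record
    { Vertex = Point
    ; Adj    = λ p₁ p₂ → ¬ (p₁ ≡ p₂) × (p₁ ∈[ f ] ω p₂)
    }

  Gaff : (Carrier → Carrier) → Graph
  Gaff f = record
    { Vertex = Carrier × Carrier
    ; Adj    = λ { (x₁ , y₁) (x₂ , y₂) → Graph.Adj (G f) (aff x₁ y₁) (aff x₂ y₂) }
    }

module Submission where

-- The isomorphism  𝒜_{q²,d} ≅ G_f[affine points]  is
--     (a^d + a , x)  ↦  (a , x + f a),        f X = X^(d+1),
-- and it matches the adjacency conditions because of the polarisation identity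
--     f (a + b) = (a^d b + a b^d) + (f a + f b),
-- valid whenever d is an additive exponent ((x + y)^d = x^d + y^d).
-- The real work is to see that ψ a = a^d + a is a permutation of F.

open import Defs

module Arithmetic where
  open import Data.Nat using (zero; suc; _*_; _∸_; _<_; _!)
  import Data.Nat.Properties as ℕ
  open import Data.Nat.Divisibility using (_∣_; divides; ∣-refl; ∣m∣n⇒∣m+n; ∣1⇒≡1; ∣⇒≤)
  open import Data.Nat.Primality using (Prime; euclidsLemma; prime⇒nonTrivial)
  open import Data.Nat.Combinatorics using (_C_; nCk≡n!/k![n-k]!; k![n∸k]!∣n!)
  open import Data.Nat.DivMod using (m/n*n≡m)
  open import Data.Nat.Base using (nonTrivial⇒≢1)
  open import Data.Fin as Fin using (Fin; punchOut)
  import Data.Fin.Properties as Fin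
  open import Data.Product using (∃; _,_)
  open import Data.Sum using (inj₁; inj₂)
  open import Data.Empty using (⊥-elim)
  open import Relation.Nullary using (¬_; yes; no)
  open import Relation.Binary.PropositionalEquality using (_≡_; sym; trans; cong; subst)

  prime∤! : ∀ {p} → Prime p → ∀ j → j < p → ¬ (p ∣ j !)
  prime∤! p-prime zero    _   p∣1 = nonTrivial⇒≢1 {{prime⇒nonTrivial p-prime}} (∣1⇒≡1 p∣1)
  prime∤! p-prime (suc j) j<p p∣j! with euclidsLemma (suc j) (j !) p-prime p∣j!
  ... | inj₁ p∣1+j = ℕ.<⇒≱ j<p (∣⇒≤ p∣1+j)
  ... | inj₂ p∣j!  = prime∤! p-prime j (ℕ.<-trans (ℕ.n<1+n j) j<p) p∣j!

  n∣n! : ∀ {n} → 0 < n → n ∣ n !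
  n∣n! {suc m} _ = divides (m !) (ℕ.*-comm (suc m) (m !))

  -- p divides the interior binomial coefficients: p C k · k! (p - k)! = p!
  -- is divisible by p while k! (p - k)! is not.
  prime∣binomial : ∀ {p k} → Prime p → 0 < k → k < p → p ∣ p C k
  prime∣binomial {p} {k} p-prime 0<k k<p
    with euclidsLemma (p C k) (k ! * (p ∸ k) !) p-prime p∣product
    where
    instance _ = ℕ._!*_!≢0 k (p ∸ k)
    p∣product : p ∣ (p C k) * (k ! * (p ∸ k) !)
    p∣product = subst (p ∣_) (sym (trans (cong (_* (k ! * (p ∸ k) !)) (nCk≡n!/k![n-k]! (ℕ.<⇒≤ k<p)))
                                          (m/n*n≡m (k![n∸k]!∣n! (ℕ.<⇒≤ k<p))))) (n∣n! (ℕ.<-trans 0<k k<p))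
  ... | inj₁ p∣C = p∣C
  ... | inj₂ p∣k![p-k]! with euclidsLemma (k !) ((p ∸ k) !) p-prime p∣k![p-k]!
  ...   | inj₁ p∣k!     = ⊥-elim (prime∤! p-prime k k<p p∣k!)
  ...   | inj₂ p∣[p-k]! = ⊥-elim (prime∤! p-prime (p ∸ k) (ℕ.∸-monoʳ-< 0<k (ℕ.<⇒≤ k<p)) p∣[p-k]!)

  odd-pred : ∀ {k} → ¬ (2 ∣ suc (suc k)) → ¬ (2 ∣ k)
  odd-pred odd 2∣k = odd (∣m∣n⇒∣m+n ∣-refl 2∣k)

  -- Pigeonhole: an injective endomap of Fin n is surjective.  If y were
  -- missed, punching y out would inject Fin n into Fin (n - 1).
  injective⇒surjective : ∀ {n} (f : Fin n → Fin n) → (∀ {a b} → f a ≡ f b → a ≡ b) →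
                         ∀ y → ∃ λ x → f x ≡ y
  injective⇒surjective {suc m} f f-injective y with Fin.any? (λ x → f x Fin.≟ y)
  ... | yes hit = hit
  ... | no miss = ⊥-elim (ℕ.1+n≰n (Fin.injective⇒≤ {f = squeeze} squeeze-injective))
    where
    avoids : ∀ i → ¬ (y ≡ f i)
    avoids i y≡fi = miss (i , sym y≡fi)
    squeeze : Fin (suc m) → Fin m
    squeeze i = punchOut (avoids i)
    squeeze-injective : ∀ {a b} → squeeze a ≡ squeeze b → a ≡ b
    squeeze-injective {a} {b} eq = f-injective (Fin.punchOut-injective (avoids a) (avoids b) eq)

module FieldTheory (F : Field) where
  open import Level using (0ℓ)
  open import Data.Nat as ℕ using (ℕ; zero; suc)
  import Data.Nat.Properties as ℕ
  open import Data.Nat.Divisibility using (_∣_; divides; _∣0)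
  open import Data.Nat.Primality using (Prime; prime⇒nonTrivial)
  open import Data.Nat.Combinatorics using (_C_; nCn≡1)
  open import Data.Fin as Fin using (Fin)
  import Data.Fin.Properties as Fin
  open import Data.Product using (Σ; _×_; _,_; proj₁; proj₂)
  open import Data.Empty using (⊥-elim)
  open import Relation.Nullary using (¬_; Dec; yes; no)
  open import Relation.Binary.PropositionalEquality
    using (_≡_; refl; sym; trans; cong; cong₂; subst; subst₂; module ≡-Reasoning)
  open import Algebra.Bundles using (CommutativeRing; CommutativeMonoid)
  open import Function.Bundles using (_⤖_; _↔_; Bijection; Surjection; mk↔ₛ′)
  import Algebra.Properties.CommutativeSemiring.Binomial
  import Algebra.Properties.CommutativeMonoid.Sum
  open ≡-Reasoning
  open Arithmetic

  open Field F using (Carrier; _+_; _*_; -_; 0#; 1#; _-_; isCommutativeRing; 0≢1; inverse)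
    renaming (_^_ to _^ᶠ_)

  R : CommutativeRing 0ℓ 0ℓ
  R = record { isCommutativeRing = isCommutativeRing }

  open CommutativeRing R using (+-assoc; +-comm; *-assoc; *-comm; +-identityˡ; +-identityʳ;
    *-identityˡ; *-identityʳ; -‿inverseʳ; distribʳ; zeroˡ; zeroʳ; ring; semiring;
    commutativeSemiring; +-commutativeSemigroup; +-commutativeMonoid; *-commutativeMonoid)
  open import Algebra.Properties.Ring ring
    using (-‿involutive; +-inverseˡ-unique; +-inverseʳ-unique; +-identityʳ-unique; -‿+-comm; x+x≈x⇒x≈0;
           x∙y⁻¹≈ε⇒x≈y; x≈y⇒x∙y⁻¹≈ε; //-rightDividesˡ; //-rightDividesʳ; +-cancelʳ)
  open import Algebra.Properties.CommutativeSemigroup +-commutativeSemigroup using (interchange)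
  open import Algebra.Solver.Ring.NaturalCoefficients.Default commutativeSemiring using (solve; _:+_; _:*_; _:=_)
  open import Algebra.Properties.Semiring.Exp semiring using (_^_; ^-homo-*; ^-assocʳ)
  open import Algebra.Properties.Semiring.Mult semiring
    using (×-assoc-*; ×1-homo-*; ×-assocˡ) renaming (_×_ to _·_)

  module SumF  = Algebra.Properties.CommutativeMonoid.Sum +-commutativeMonoid
  module ProdF = Algebra.Properties.CommutativeMonoid.Sum *-commutativeMonoid

  -- The power of Defs agrees with the library's monoid power, whose laws we use.
  ^ᶠ≡^ : ∀ x m → x ^ᶠ m ≡ x ^ m
  ^ᶠ≡^ x zero    = refl
  ^ᶠ≡^ x (suc m) = cong (x *_) (^ᶠ≡^ x m)

  *-cancelʳ : ∀ x y z → ¬ (z ≡ 0#) → x * z ≡ y * z → x ≡ y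
  *-cancelʳ x y z z≢0 eq = begin
    x                 ≡⟨ sym (*-identityʳ x) ⟩
    x * 1#            ≡⟨ cong (x *_) (sym z*z⁻¹≡1) ⟩
    x * (z * z⁻¹)     ≡⟨ sym (*-assoc x z z⁻¹) ⟩
    (x * z) * z⁻¹     ≡⟨ cong (_* z⁻¹) eq ⟩
    (y * z) * z⁻¹     ≡⟨ *-assoc y z z⁻¹ ⟩
    y * (z * z⁻¹)     ≡⟨ cong (y *_) z*z⁻¹≡1 ⟩
    y * 1#            ≡⟨ *-identityʳ y ⟩
    y                 ∎
    where
    z⁻¹ : Carrier
    z⁻¹ = proj₁ (inverse z z≢0)
    z*z⁻¹≡1 : z * z⁻¹ ≡ 1#
    z*z⁻¹≡1 = proj₂ (inverse z z≢0)

  *-nonzero : ∀ x y → ¬ (x ≡ 0#) → ¬ (y ≡ 0#) → ¬ (x * y ≡ 0#)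
  *-nonzero x y x≢0 y≢0 xy≡0 = x≢0 (*-cancelʳ x 0# y y≢0 (trans xy≡0 (sym (zeroˡ y))))

  ^-nonzero : ∀ x m → ¬ (x ≡ 0#) → ¬ (x ^ m ≡ 0#)
  ^-nonzero x zero    _   1≡0 = 0≢1 (sym 1≡0)
  ^-nonzero x (suc m) x≢0     = *-nonzero x (x ^ m) x≢0 (^-nonzero x m x≢0)

  product-nonzero : ∀ {n} (t : Fin n → Carrier) → (∀ i → ¬ (t i ≡ 0#)) → ¬ (ProdF.sum t ≡ 0#)
  product-nonzero {zero}  t _        1≡0 = 0≢1 (sym 1≡0)
  product-nonzero {suc n} t nonzero =
    *-nonzero _ _ (nonzero Fin.zero) (product-nonzero (λ i → t (Fin.suc i)) (λ i → nonzero (Fin.suc i)))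

  product-single : ∀ {n} (t : Fin n → Carrier) (i : Fin n) → (∀ j → ¬ (j ≡ i) → t j ≡ 1#) →
                   ProdF.sum t ≡ t i
  product-single {suc n} t Fin.zero ones = begin
    t Fin.zero * ProdF.sum (λ j → t (Fin.suc j))  ≡⟨ cong (t Fin.zero *_) rest≡1 ⟩
    t Fin.zero * 1#                               ≡⟨ *-identityʳ _ ⟩
    t Fin.zero                                    ∎
    where
    rest≡1 : ProdF.sum (λ j → t (Fin.suc j)) ≡ 1#
    rest≡1 = trans (ProdF.sum-cong-≗ (λ j → ones (Fin.suc j) (λ ()))) (ProdF.sum-replicate-zero n)
  product-single {suc n} t (Fin.suc i) ones = begin
    t Fin.zero * ProdF.sum (λ j → t (Fin.suc j))  ≡⟨ cong₂ _*_ (ones Fin.zero (λ ())) rest≡tᵢ ⟩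
    1# * t (Fin.suc i)                            ≡⟨ *-identityˡ _ ⟩
    t (Fin.suc i)                                 ∎
    where
    rest≡tᵢ : ProdF.sum (λ j → t (Fin.suc j)) ≡ t (Fin.suc i)
    rest≡tᵢ = product-single (λ j → t (Fin.suc j)) i
                (λ j j≢i → ones (Fin.suc j) (λ eq → j≢i (Fin.suc-injective eq)))

  self-negative⇒zero : ¬ (1# + 1# ≡ 0#) → ∀ a → a ≡ - a → a ≡ 0#
  self-negative⇒zero 2≢0 a a≡-a = *-cancelʳ a 0# (1# + 1#) 2≢0 (begin
    a * (1# + 1#)     ≡⟨ *-comm a _ ⟩
    (1# + 1#) * a     ≡⟨ distribʳ a 1# 1# ⟩
    1# * a + 1# * a   ≡⟨ cong₂ _+_ (*-identityˡ a) (*-identityˡ a) ⟩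
    a + a             ≡⟨ cong (a +_) a≡-a ⟩
    a + - a           ≡⟨ -‿inverseʳ a ⟩
    0#                ≡⟨ sym (zeroˡ _) ⟩
    0# * (1# + 1#)    ∎)

  ≡-minus⇒+≡ : ∀ {x y z} → x ≡ z - y → x + y ≡ z
  ≡-minus⇒+≡ {x} {y} {z} eq = trans (cong (_+ y) eq) (//-rightDividesˡ y z)

  +≡⇒≡-minus : ∀ {x y z} → x + y ≡ z → x ≡ z - y
  +≡⇒≡-minus {x} {y} {z} eq = trans (sym (//-rightDividesʳ y x)) (cong (_- y) eq)

  ·1-homo-^ : ∀ m k → (m ℕ.^ k) · 1# ≡ (m · 1#) ^ k
  ·1-homo-^ m zero    = +-identityʳ 1#
  ·1-homo-^ m (suc k) = trans (×1-homo-* m (m ℕ.^ k)) (cong ((m · 1#) *_) (·1-homo-^ m k))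

  odd·1≡1 : 1# + 1# ≡ 0# → ∀ m → ¬ (2 ∣ m) → m · 1# ≡ 1#
  odd·1≡1 _   zero          odd = ⊥-elim (odd (2 ∣0))
  odd·1≡1 _   (suc zero)    _   = +-identityʳ 1#
  odd·1≡1 2≡0 (suc (suc m)) odd = begin
    1# + (1# + m · 1#)  ≡⟨ sym (+-assoc 1# 1# _) ⟩
    (1# + 1#) + m · 1#  ≡⟨ cong (_+ m · 1#) 2≡0 ⟩
    0# + m · 1#         ≡⟨ +-identityˡ _ ⟩
    m · 1#              ≡⟨ odd·1≡1 2≡0 m (odd-pred odd) ⟩
    1#                  ∎

  char-multiple : ∀ {p} → p · 1# ≡ 0# → ∀ c z → p ∣ c → c · z ≡ 0#
  char-multiple {p} p·1≡0 c z (divides r refl) = begin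
    (r ℕ.* p) · z       ≡⟨ sym (×-assocˡ z r p) ⟩
    r · (p · z)         ≡⟨ cong (r ·_) p·z≡0 ⟩
    r · 0#              ≡⟨ r·0≡0 r ⟩
    0#                  ∎
    where
    p·z≡0 : p · z ≡ 0#
    p·z≡0 = begin
      p · z             ≡⟨ cong (p ·_) (sym (*-identityˡ z)) ⟩
      p · (1# * z)      ≡⟨ sym (×-assoc-* p 1# z) ⟩
      (p · 1#) * z      ≡⟨ cong (_* z) p·1≡0 ⟩
      0# * z            ≡⟨ zeroˡ z ⟩
      0#                ∎
    r·0≡0 : ∀ r → r · 0# ≡ 0#
    r·0≡0 zero    = refl
    r·0≡0 (suc r) = trans (+-identityˡ _) (r·0≡0 r)

  Additive : ℕ → Set
  Additive n = ∀ x y → (x + y) ^ n ≡ x ^ n + y ^ n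

  additive-* : ∀ {m n} → Additive m → Additive n → Additive (m ℕ.* n)
  additive-* {m} {n} m-additive n-additive x y = begin
    (x + y) ^ (m ℕ.* n)         ≡⟨ sym (^-assocʳ (x + y) m n) ⟩
    ((x + y) ^ m) ^ n           ≡⟨ cong (_^ n) (m-additive x y) ⟩
    (x ^ m + y ^ m) ^ n         ≡⟨ n-additive _ _ ⟩
    (x ^ m) ^ n + (y ^ m) ^ n   ≡⟨ cong₂ _+_ (^-assocʳ x m n) (^-assocʳ y m n) ⟩
    x ^ (m ℕ.* n) + y ^ (m ℕ.* n) ∎

  additive-^ : ∀ {m} → Additive m → ∀ k → Additive (m ℕ.^ k)
  additive-^ m-additive zero    x y = distribʳ 1# x y
  additive-^ {m} m-additive (suc k) = additive-* {m} {m ℕ.^ k} m-additive (additive-^ m-additive k)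

  -- An additive power map is odd: x ^ n + (- x) ^ n = 0 ^ n = 0.
  additive-neg : ∀ {n} → Additive n → ∀ x → (- x) ^ n ≡ - (x ^ n)
  additive-neg {n} n-additive x = +-inverseʳ-unique (x ^ n) ((- x) ^ n) (begin
    x ^ n + (- x) ^ n   ≡⟨ sym (n-additive x (- x)) ⟩
    (x + - x) ^ n       ≡⟨ cong (_^ n) (-‿inverseʳ x) ⟩
    0# ^ n              ≡⟨ x+x≈x⇒x≈0 (0# ^ n) 0ⁿ+0ⁿ≡0ⁿ ⟩
    0#                  ∎)
    where
    0ⁿ+0ⁿ≡0ⁿ : 0# ^ n + 0# ^ n ≡ 0# ^ n
    0ⁿ+0ⁿ≡0ⁿ = trans (sym (n-additive 0# 0#)) (cong (_^ n) (+-identityʳ 0#))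

  -- Frobenius: in characteristic p the p-th power map is additive, since
  -- all interior binomial coefficients p C k vanish.
  frobenius : ∀ {p} → Prime p → p · 1# ≡ 0# → Additive p
  frobenius {zero}              p-prime _ = ⊥-elim (ℕ.n≮0 (ℕ.nonTrivial⇒n>1 0 {{prime⇒nonTrivial p-prime}}))
  frobenius {suc zero}          p-prime _ = ⊥-elim (ℕ.n≮n 1 (ℕ.nonTrivial⇒n>1 1 {{prime⇒nonTrivial p-prime}}))
  frobenius {p@(suc (suc m))} p-prime p·1≡0 x y = begin
    (x + y) ^ p
      ≡⟨ Bin.theorem p x y ⟩
    term Fin.zero + SumF.sum (λ k → term (Fin.suc k))
      ≡⟨ cong (term Fin.zero +_) (SumF.sum-init-last (λ k → term (Fin.suc k))) ⟩
    term Fin.zero + (SumF.sum interior + term (Fin.suc (Fin.fromℕ (suc m))))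
      ≡⟨ cong₂ _+_ (trans (+-identityʳ _) (*-identityˡ _)) (cong₂ _+_ interior≡0 last≡xᵖ) ⟩
    y ^ p + (0# + x ^ p)
      ≡⟨ trans (cong (y ^ p +_) (+-identityˡ _)) (+-comm _ _) ⟩
    x ^ p + y ^ p ∎
    where
    module Bin  = Algebra.Properties.CommutativeSemiring.Binomial commutativeSemiring
    term : Fin (suc p) → Carrier
    term = Bin.binomialTerm x y p
    interior : Fin (suc m) → Carrier
    interior j = term (Fin.suc (Fin.inject₁ j))
    interior≡0 : SumF.sum interior ≡ 0#
    interior≡0 = trans (SumF.sum-cong-≗ vanishes) (SumF.sum-replicate-zero (suc m))
      where
      vanishes : ∀ j → interior j ≡ 0#
      vanishes j = char-multiple p·1≡0 _ _ (prime∣binomial p-prime (ℕ.s≤s ℕ.z≤n)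
        (ℕ.s≤s (subst (ℕ._< suc m) (sym (Fin.toℕ-inject₁ j)) (Fin.toℕ<n j))))
    last≡xᵖ : term (Fin.suc (Fin.fromℕ (suc m))) ≡ x ^ p
    last≡xᵖ = begin
      term (Fin.suc (Fin.fromℕ (suc m)))
        ≡⟨ cong (λ k → (p C k) · (x ^ k * y ^ (p ℕ.∸ k))) (cong suc (Fin.toℕ-fromℕ (suc m))) ⟩
      (p C p) · (x ^ p * y ^ (p ℕ.∸ p))
        ≡⟨ cong₂ (λ c k → c · (x ^ p * y ^ k)) (nCn≡1 p) (ℕ.n∸n≡0 p) ⟩
      1 · (x ^ p * 1#)
        ≡⟨ trans (+-identityʳ _) (*-identityʳ _) ⟩
      x ^ p ∎

  module Finite {N : ℕ} (enumeration : Carrier ⤖ Fin N) where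
    open Bijection enumeration using (surjection) renaming (to to index; injective to index-injective)
    open Surjection surjection using () renaming (to⁻ to element; to∘to⁻ to index-element)

    element-index : ∀ x → element (index x) ≡ x
    element-index x = index-injective (index-element (index x))

    infix 4 _≟_
    _≟_ : (x y : Carrier) → Dec (x ≡ y)
    x ≟ y with index x Fin.≟ index y
    ... | yes same = yes (index-injective same)
    ... | no  diff = no (λ x≡y → diff (cong index x≡y))

    injective⇒inverse : (f : Carrier → Carrier) → (∀ {a b} → f a ≡ f b → a ≡ b) →
                        Σ (Carrier → Carrier) λ f⁻¹ → ∀ u → f (f⁻¹ u) ≡ u
    injective⇒inverse f f-injective = f⁻¹ , f∘f⁻¹
      where
      f̂ : Fin N → Fin N
      f̂ i = index (f (element i))
      f̂-injective : ∀ {i j} → f̂ i ≡ f̂ j → i ≡ j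
      f̂-injective {i} {j} eq = trans (sym (index-element i))
        (trans (cong index (f-injective (index-injective eq))) (index-element j))
      f⁻¹ : Carrier → Carrier
      f⁻¹ u = element (proj₁ (injective⇒surjective f̂ f̂-injective (index u)))
      f∘f⁻¹ : ∀ u → f (f⁻¹ u) ≡ u
      f∘f⁻¹ u = index-injective (proj₂ (injective⇒surjective f̂ f̂-injective (index u)))

    module Reindex {c ℓ} (M : CommutativeMonoid c ℓ) where
      open CommutativeMonoid M using (_≈_; reflexive) renaming (Carrier to M-Carrier; trans to ≈-trans; sym to ≈-sym)
      open Algebra.Properties.CommutativeMonoid.Sum M using (sum; sum-permute; sum-cong-≗)

      sum-reindex : (σ σ⁻¹ : Carrier → Carrier) → (∀ x → σ (σ⁻¹ x) ≡ x) → (∀ x → σ⁻¹ (σ x) ≡ x) →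
                    (g : Carrier → M-Carrier) →
                    sum (λ i → g (σ (element i))) ≈ sum (λ i → g (element i))
      sum-reindex σ σ⁻¹ σσ⁻¹ σ⁻¹σ g = ≈-trans
        (reflexive (sum-cong-≗ (λ i → cong g (sym (element-index (σ (element i)))))))
        (≈-sym (sum-permute (λ i → g (element i)) π))
        where
        conjugate : ∀ (τ τ' : Carrier → Carrier) → (∀ x → τ (τ' x) ≡ x) → ∀ i →
                    index (τ (element (index (τ' (element i))))) ≡ i
        conjugate τ τ' ττ' i = trans (cong (λ z → index (τ z)) (element-index (τ' (element i))))
                                     (trans (cong index (ττ' (element i))) (index-element i))
        π : Fin N ↔ Fin N
        π = mk↔ₛ′ (λ i → index (σ (element i))) (λ i → index (σ⁻¹ (element i)))
                  (conjugate σ σ⁻¹ σσ⁻¹) (conjugate σ⁻¹ σ σ⁻¹σ)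

    -- N · 1 = 0: translating by 1 permutes F, so Σ x = Σ (x + 1) = Σ x + N · 1.
    N·1≡0 : N · 1# ≡ 0#
    N·1≡0 = +-identityʳ-unique S (N · 1#) (begin
      S + N · 1#                       ≡⟨ cong (S +_) (sym (SumF.sum-replicate N)) ⟩
      S + SumF.sum {N} (λ _ → 1#)      ≡⟨ sym (SumF.∑-distrib-+ element (λ _ → 1#)) ⟩
      SumF.sum (λ i → element i + 1#)  ≡⟨ Reindex.sum-reindex +-commutativeMonoid (_+ 1#) (_- 1#)
                                            (//-rightDividesˡ 1#) (//-rightDividesʳ 1#) (λ x → x) ⟩
      S                                ∎)
      where
      S : Carrier
      S = SumF.sum element

    -- If F has p^m elements then F has characteristic p: (p · 1)^m = p^m · 1 = 0.
    characteristic : ∀ p m → N ≡ p ℕ.^ m → p · 1# ≡ 0#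
    characteristic p m N≡pᵐ with p · 1# ≟ 0#
    ... | yes p·1≡0 = p·1≡0
    ... | no  p·1≢0 = ⊥-elim (^-nonzero (p · 1#) m p·1≢0 (begin
      (p · 1#) ^ m      ≡⟨ sym (·1-homo-^ p m) ⟩
      (p ℕ.^ m) · 1#    ≡⟨ cong (_· 1#) (sym N≡pᵐ) ⟩
      N · 1#            ≡⟨ N·1≡0 ⟩
      0#                ∎))

    -- For a ≠ 0 multiplication by a permutes F.
    -- To keep the product of all elements nonzero, 0 is counted as 1 there:
    -- with unit x = (x if x ≠ 0, 1 if x = 0) we have
    --   a · unit x = unit (a x) · correction x,  correction x = (1 if x ≠ 0, a if x = 0),
    -- so a^N · P = P · a for P = Π unit x ≠ 0.
    fermat : ∀ a → a ^ N ≡ a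
    fermat a with a ≟ 0#
    ... | yes refl = zero-power (index 0#)
      where
      zero-power : ∀ {n} → Fin n → 0# ^ n ≡ 0#
      zero-power {suc n} _ = zeroˡ _
    ... | no a≢0 = *-cancelʳ _ _ P P≢0 (begin
      a ^ N * P                                   ≡⟨ cong (_* P) (sym (ProdF.sum-replicate N)) ⟩
      ProdF.sum {N} (λ _ → a) * P                 ≡⟨ sym (ProdF.∑-distrib-+ (λ _ → a) (λ i → unit (element i))) ⟩
      ProdF.sum (λ i → a * unit (element i))      ≡⟨ ProdF.sum-cong-≗ (λ i → scale (element i)) ⟩
      ProdF.sum (λ i → unit (a * element i) * correction (element i))
                                                  ≡⟨ ProdF.∑-distrib-+ (λ i → unit (a * element i)) (λ i → correction (element i)) ⟩
      ProdF.sum (λ i → unit (a * element i)) * ProdF.sum (λ i → correction (element i))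
                                                  ≡⟨ cong₂ _*_ unit-reindex correction-product ⟩
      P * a                                       ≡⟨ *-comm P a ⟩
      a * P                                       ∎)
      where
      unit : Carrier → Carrier
      unit x with x ≟ 0#
      ... | yes _ = 1#
      ... | no  _ = x

      correction : Carrier → Carrier
      correction x with x ≟ 0#
      ... | yes _ = a
      ... | no  _ = 1#

      unit-nonzero : ∀ x → ¬ (unit x ≡ 0#)
      unit-nonzero x with x ≟ 0#
      ... | yes _   = λ 1≡0 → 0≢1 (sym 1≡0)
      ... | no  x≢0 = x≢0

      unit-of-product : ∀ x → (x ≡ 0# → unit (a * x) ≡ 1#) × (¬ (x ≡ 0#) → unit (a * x) ≡ a * x)
      unit-of-product x with a * x ≟ 0#
      ... | yes ax≡0 = (λ _ → refl) , (λ x≢0 → ⊥-elim (*-nonzero a x a≢0 x≢0 ax≡0))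
      ... | no  ax≢0 = (λ x≡0 → ⊥-elim (ax≢0 (trans (cong (a *_) x≡0) (zeroʳ a)))) , (λ _ → refl)

      scale : ∀ x → a * unit x ≡ unit (a * x) * correction x
      scale x with x ≟ 0#
      ... | yes x≡0 = trans (*-identityʳ a) (sym (trans (cong (_* a) (proj₁ (unit-of-product x) x≡0)) (*-identityˡ a)))
      ... | no  x≢0 = trans (sym (*-identityʳ _)) (cong (_* 1#) (sym (proj₂ (unit-of-product x) x≢0)))

      P : Carrier
      P = ProdF.sum (λ i → unit (element i))

      P≢0 : ¬ (P ≡ 0#)
      P≢0 = product-nonzero _ (λ i → unit-nonzero (element i))

      a⁻¹ : Carrier
      a⁻¹ = proj₁ (inverse a a≢0)
      a*a⁻¹≡1 : a * a⁻¹ ≡ 1#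
      a*a⁻¹≡1 = proj₂ (inverse a a≢0)

      unit-reindex : ProdF.sum (λ i → unit (a * element i)) ≡ P
      unit-reindex = Reindex.sum-reindex *-commutativeMonoid (a *_) (a⁻¹ *_) cancel cancel′ unit
        where
        cancel : ∀ x → a * (a⁻¹ * x) ≡ x
        cancel x = trans (sym (*-assoc a a⁻¹ x)) (trans (cong (_* x) a*a⁻¹≡1) (*-identityˡ x))
        cancel′ : ∀ x → a⁻¹ * (a * x) ≡ x
        cancel′ x = trans (sym (*-assoc a⁻¹ a x)) (trans (cong (_* x) (trans (*-comm a⁻¹ a) a*a⁻¹≡1)) (*-identityˡ x))

      correction-product : ProdF.sum (λ i → correction (element i)) ≡ a
      correction-product = trans (product-single _ (index 0#) ones) (trans (cong correction (element-index 0#)) at-zero)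
        where
        at-zero : correction 0# ≡ a
        at-zero with 0# ≟ 0#
        ... | yes _  = refl
        ... | no 0≢0 = ⊥-elim (0≢0 refl)
        ones : ∀ j → ¬ (j ≡ index 0#) → correction (element j) ≡ 1#
        ones j j≢0 with element j ≟ 0#
        ... | yes eⱼ≡0 = ⊥-elim (j≢0 (trans (sym (index-element j)) (cong index eⱼ≡0)))
        ... | no  _    = refl

  ψ : ℕ → Carrier → Carrier
  ψ d a = a ^ d + a

  -- For an additive exponent d, ψ d is additive with trivial kernel, hence injective,
  -- provided 2 ≠ 0 and the (d^k)-th power map is the identity for some odd k.
  module Injectivity (d : ℕ) (d-additive : Additive d) where
    ψ-minus : ∀ a b → ψ d (a - b) ≡ ψ d a - ψ d b
    ψ-minus a b = begin
      (a - b) ^ d + (a - b)               ≡⟨ cong (_+ (a - b)) (d-additive a (- b)) ⟩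
      (a ^ d + (- b) ^ d) + (a + - b)     ≡⟨ cong (λ z → (a ^ d + z) + (a + - b)) (additive-neg {d} d-additive b) ⟩
      (a ^ d + - (b ^ d)) + (a + - b)     ≡⟨ interchange (a ^ d) (- (b ^ d)) a (- b) ⟩
      (a ^ d + a) + (- (b ^ d) + - b)     ≡⟨ cong (ψ d a +_) (-‿+-comm (b ^ d) b) ⟩
      ψ d a - ψ d b                       ∎

    -- If a^d = -a then a^(d^k) = -a for odd k, because a^(d·d) = (-a)^d = a.
    odd-iterate : ∀ a → a ^ d ≡ - a → ∀ k → ¬ (2 ∣ k) → a ^ (d ℕ.^ k) ≡ - a
    odd-iterate a aᵈ≡-a zero          odd = ⊥-elim (odd (2 ∣0))
    odd-iterate a aᵈ≡-a (suc zero)    _   = trans (cong (a ^_) (ℕ.*-identityʳ d)) aᵈ≡-a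
    odd-iterate a aᵈ≡-a (suc (suc k)) odd = begin
      a ^ (d ℕ.* (d ℕ.* d ℕ.^ k))   ≡⟨ cong (a ^_) (sym (ℕ.*-assoc d d (d ℕ.^ k))) ⟩
      a ^ (d ℕ.* d ℕ.* d ℕ.^ k)     ≡⟨ sym (^-assocʳ a (d ℕ.* d) (d ℕ.^ k)) ⟩
      (a ^ (d ℕ.* d)) ^ (d ℕ.^ k)   ≡⟨ cong (_^ (d ℕ.^ k)) period ⟩
      a ^ (d ℕ.^ k)                 ≡⟨ odd-iterate a aᵈ≡-a k (odd-pred odd) ⟩
      - a                           ∎
      where
      period : a ^ (d ℕ.* d) ≡ a
      period = begin
        a ^ (d ℕ.* d)   ≡⟨ sym (^-assocʳ a d d) ⟩
        (a ^ d) ^ d     ≡⟨ cong (_^ d) aᵈ≡-a ⟩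
        (- a) ^ d       ≡⟨ additive-neg {d} d-additive a ⟩
        - (a ^ d)       ≡⟨ cong -_ aᵈ≡-a ⟩
        - - a           ≡⟨ -‿involutive a ⟩
        a               ∎

    ψ-injective : ¬ (1# + 1# ≡ 0#) → ∀ k → ¬ (2 ∣ k) → (∀ a → a ^ (d ℕ.^ k) ≡ a) →
                  ∀ {a b} → ψ d a ≡ ψ d b → a ≡ b
    ψ-injective 2≢0 k odd fixed {a} {b} ψa≡ψb =
      x∙y⁻¹≈ε⇒x≈y a b (kernel (a - b) (trans (ψ-minus a b) (x≈y⇒x∙y⁻¹≈ε ψa≡ψb)))
      where
      kernel : ∀ c → ψ d c ≡ 0# → c ≡ 0#
      kernel c ψc≡0 = self-negative⇒zero 2≢0 c
        (trans (sym (fixed c)) (odd-iterate c (+-inverseˡ-unique (c ^ d) c ψc≡0) k odd))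

  module Isomorphism (d : ℕ) (d-additive : Additive d) (ψ⁻¹ : Carrier → Carrier)
                     (ψψ⁻¹ : ∀ u → ψ d (ψ⁻¹ u) ≡ u) (ψ⁻¹ψ : ∀ a → ψ⁻¹ (ψ d a) ≡ a) where
    f : Carrier → Carrier
    f X = X ^ᶠ (d ℕ.+ 1)

    f-unfold : ∀ X → f X ≡ X ^ d * X
    f-unfold X = trans (^ᶠ≡^ X (d ℕ.+ 1)) (trans (^-homo-* X d 1) (cong (X ^ d *_) (*-identityʳ X)))

    cross : Carrier → Carrier → Carrier
    cross a b = a ^ d * b + a * b ^ d

    polarisation : ∀ a b → f (a + b) ≡ cross a b + (f a + f b)
    polarisation a b = begin
      f (a + b)                                   ≡⟨ f-unfold (a + b) ⟩
      (a + b) ^ d * (a + b)                       ≡⟨ cong (_* (a + b)) (d-additive a b) ⟩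
      (a ^ d + b ^ d) * (a + b)                   ≡⟨ expand a b (a ^ d) (b ^ d) ⟩
      cross a b + (a ^ d * a + b ^ d * b)         ≡⟨ cong (cross a b +_) (sym (cong₂ _+_ (f-unfold a) (f-unfold b))) ⟩
      cross a b + (f a + f b)                     ∎
      where
      expand : ∀ a b A B → (A + B) * (a + b) ≡ (A * b + a * B) + (A * a + B * b)
      expand = solve 4 (λ a b A B → (A :+ B) :* (a :+ b) := (A :* b :+ a :* B) :+ (A :* a :+ B :* b)) refl

    -- The adjacency conditions of 𝒜 and of G_f correspond under the shift
    -- x ↦ x + f a, y ↦ y + f b.
    shift-adjacency : ∀ a b x y → cross a b ≡ x + y → x + f a ≡ f (a - (- b)) + - (y + f b)
    shift-adjacency a b x y cross≡x+y = +≡⇒≡-minus (begin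
      (x + f a) + (y + f b)   ≡⟨ interchange x (f a) y (f b) ⟩
      (x + y) + (f a + f b)   ≡⟨ cong (_+ (f a + f b)) (sym cross≡x+y) ⟩
      cross a b + (f a + f b) ≡⟨ sym (polarisation a b) ⟩
      f (a + b)               ≡⟨ cong (λ z → f (a + z)) (sym (-‿involutive b)) ⟩
      f (a - (- b))             ∎)

    unshift-adjacency : ∀ a b x y → x + f a ≡ f (a - (- b)) + - (y + f b) → cross a b ≡ x + y
    unshift-adjacency a b x y shifted = sym (+-cancelʳ (f a + f b) (x + y) (cross a b) (begin
      (x + y) + (f a + f b)   ≡⟨ sym (interchange x (f a) y (f b)) ⟩
      (x + f a) + (y + f b)   ≡⟨ ≡-minus⇒+≡ shifted ⟩
      f (a - (- b))             ≡⟨ cong (λ z → f (a + z)) (-‿involutive b) ⟩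
      f (a + b)               ≡⟨ polarisation a b ⟩
      cross a b + (f a + f b) ∎))

    φ-to : Carrier × Carrier → Carrier × Carrier
    φ-to (u , x) = (ψ⁻¹ u , x + f (ψ⁻¹ u))

    φ-from : Carrier × Carrier → Carrier × Carrier
    φ-from (a , y) = (ψ d a , y - f a)

    φ-from-to : ∀ w → φ-from (φ-to w) ≡ w
    φ-from-to (u , x) = cong₂ _,_ (ψψ⁻¹ u) (//-rightDividesʳ (f (ψ⁻¹ u)) x)

    φ-to-from : ∀ w → φ-to (φ-from w) ≡ w
    φ-to-from (a , y) = cong₂ _,_ (ψ⁻¹ψ a)
      (trans (cong (λ c → (y - f a) + f c) (ψ⁻¹ψ a)) (//-rightDividesˡ (f a) y))

    φ : (Carrier × Carrier) ↔ (Carrier × Carrier)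
    φ = mk↔ₛ′ φ-to φ-from φ-to-from φ-from-to

    recover : ∀ {u a} → u ≡ a ^ᶠ d + a → ψ⁻¹ u ≡ a
    recover {u} {a} u≡ψa = trans (cong ψ⁻¹ (trans u≡ψa (cong (_+ a) (^ᶠ≡^ a d)))) (ψ⁻¹ψ a)

    represent : ∀ u → u ≡ ψ⁻¹ u ^ᶠ d + ψ⁻¹ u
    represent u = trans (sym (ψψ⁻¹ u)) (cong (_+ ψ⁻¹ u) (sym (^ᶠ≡^ (ψ⁻¹ u) d)))

    crossᶠ : ∀ a b → a ^ᶠ d * b + a * b ^ᶠ d ≡ cross a b
    crossᶠ a b = cong₂ (λ A B → A * b + a * B) (^ᶠ≡^ a d) (^ᶠ≡^ b d)

    aff-injective : ∀ {x₁ y₁ x₂ y₂} → aff {F} x₁ y₁ ≡ aff x₂ y₂ → (x₁ , y₁) ≡ (x₂ , y₂)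
    aff-injective refl = refl

    preserves : ∀ u x v y → Graph.Adj (𝒜 F d) (u , x) (v , y) →
                Graph.Adj (Gaff F f) (φ-to (u , x)) (φ-to (v , y))
    preserves u x v y (distinct , a , b , u≡ψa , v≡ψb , cross≡x+y) = distinct′ , aff∈lab adjacent
      where
      distinct′ : ¬ (aff {F} (ψ⁻¹ u) (x + f (ψ⁻¹ u)) ≡ aff (ψ⁻¹ v) (y + f (ψ⁻¹ v)))
      distinct′ same = distinct (begin
        (u , x)                  ≡⟨ sym (φ-from-to (u , x)) ⟩
        φ-from (φ-to (u , x))    ≡⟨ cong φ-from (aff-injective same) ⟩
        φ-from (φ-to (v , y))    ≡⟨ φ-from-to (v , y) ⟩
        (v , y)                  ∎)
      adjacent : x + f (ψ⁻¹ u) ≡ f (ψ⁻¹ u - (- ψ⁻¹ v)) + - (y + f (ψ⁻¹ v))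
      adjacent = subst₂ (λ a′ b′ → x + f a′ ≡ f (a′ - (- b′)) + - (y + f b′))
        (sym (recover u≡ψa)) (sym (recover v≡ψb))
        (shift-adjacency a b x y (trans (sym (crossᶠ a b)) cross≡x+y))

    reflects : ∀ u x v y → Graph.Adj (Gaff F f) (φ-to (u , x)) (φ-to (v , y)) →
               Graph.Adj (𝒜 F d) (u , x) (v , y)
    reflects u x v y (distinct , aff∈lab shifted) =
      (λ same → distinct (cong (λ w → aff (proj₁ (φ-to w)) (proj₂ (φ-to w))) same))
      , ψ⁻¹ u , ψ⁻¹ v , represent u , represent v
      , trans (crossᶠ (ψ⁻¹ u) (ψ⁻¹ v)) (unshift-adjacency (ψ⁻¹ u) (ψ⁻¹ v) x y shifted)

    isomorphism : 𝒜 F d ≅ Gaff F f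
    isomorphism = φ , λ { (u , x) (v , y) → preserves u x v y , reflects u x v y }

  -- The theorem for a finite field with N = d^k elements, d = p^s, p an odd prime
  -- and k odd: F has characteristic p, so d is additive (Frobenius); 2 ≠ 0; the
  -- (d^k)-th power map is the identity (Fermat); hence ψ d is injective, and so
  -- bijective.
  odd-degree-isomorphism : ∀ {N} → Carrier ⤖ Fin N → ∀ {p} → Prime p → ¬ (2 ∣ p) →
                           ∀ s k → ¬ (2 ∣ k) → N ≡ (p ℕ.^ s) ℕ.^ k →
                           𝒜 F (p ℕ.^ s) ≅ Gaff F (λ X → X ^ᶠ (p ℕ.^ s ℕ.+ 1))
  odd-degree-isomorphism enumeration {p} p-prime p-odd s k k-odd N≡dᵏ =
    Isomorphism.isomorphism d d-additive ψ⁻¹ ψψ⁻¹ (λ a → ψ-injective (ψψ⁻¹ (ψ d a)))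
    where
    open Finite enumeration
    d : ℕ
    d = p ℕ.^ s
    char-p : p · 1# ≡ 0#
    char-p = characteristic p (s ℕ.* k) (trans N≡dᵏ (ℕ.^-*-assoc p s k))
    2≢0 : ¬ (1# + 1# ≡ 0#)
    2≢0 2≡0 = 0≢1 (trans (sym char-p) (odd·1≡1 2≡0 p p-odd))
    d-additive : Additive d
    d-additive = additive-^ {p} (frobenius p-prime char-p) s
    ψ-injective : ∀ {a b} → ψ d a ≡ ψ d b → a ≡ b
    ψ-injective = Injectivity.ψ-injective d d-additive 2≢0 k k-odd
                    (λ a → trans (cong (a ^_) (sym N≡dᵏ)) (fermat a))
    ψ⁻¹ : Carrier → Carrier
    ψ⁻¹ = proj₁ (injective⇒inverse (ψ d) ψ-injective)
    ψψ⁻¹ : ∀ u → ψ d (ψ⁻¹ u) ≡ u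
    ψψ⁻¹ = proj₂ (injective⇒inverse (ψ d) ψ-injective)

open import Data.Nat using (ℕ; _*_; _^_; _≤_; _+_)
open import Data.Nat.Primality using (Prime)
open import Data.Nat.Divisibility using (_∣_)
open import Relation.Nullary using (¬_)
open import Relation.Binary.PropositionalEquality using (_≡_; sym; trans; cong)
import Data.Nat.Properties as ℕ

mainTheorem8 : (p n s : ℕ) → Prime p → ¬ (2 ∣ p) → 1 ≤ n → 1 ≤ s →
    (k : ℕ) → 2 * n ≡ k * s → ¬ (2 ∣ k) → 3 ≤ k →
    (F : Field) → HasOrder F ((p ^ n) ^ 2) →
    𝒜 F (p ^ s) ≅ Gaff F (λ X → Field._^_ F X (p ^ s + 1))
mainTheorem8 p n s p-prime p-odd _ _ k 2n≡ks k-odd _ F order =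
  FieldTheory.odd-degree-isomorphism F order p-prime p-odd s k k-odd |F|≡dᵏ
  where
  |F|≡dᵏ : (p ^ n) ^ 2 ≡ (p ^ s) ^ k
  |F|≡dᵏ = trans (ℕ.^-*-assoc p n 2)
             (trans (cong (p ^_) (trans (ℕ.*-comm n 2) (trans 2n≡ks (ℕ.*-comm k s))))
                    (sym (ℕ.^-*-assoc p s k)))
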